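{- Let $F$ be a field and let $q$ be a non-degenerate quadratic form of dimension $2$ on $V$ which represents $1$. For $a\in F^\ast$, there exists $w\in V_1+V_1$ with $q(w)=a$ if and only if $\det(q)\cdot(4a-a^2)$ is a square in $F$, in case $\mathrm{char}(F)\ne 2$, respectively $\Delta(q)+\frac1a\in\wp(F)$, in case $\mathrm{char}(F)=2$.
   Context: A quadratic form on a finite-dimensional $F$-vector space $V$ is a map $q:V\to F$ with $q(\lambda x)=\lambda^2q(x)$ such that $b_q(x,y)=q(x+y)-q(x)-q(y)$ is bilinear; non-degenerate means $\{x: b_q(x,y)=0\ \forall y\}=\{0\}$. $V_1=\{x\in V:q(x)=1\}$ and $V_1+V_1=\{u+v:u,v\in V_1\}$. For $\mathrm{char}(F)\ne2$, $\det(q)\in F^\ast/F^{\ast2}$ is the class of $\det A$, where $q(x)=x^TAx$ with $A$ symmetric in some basis. For $\mathrm{char}(F)=2$, $\wp(x)=x^2+x$ is the Artin–Schreier map and the Arf invariant of $q\cong[\alpha,\beta]$ (where $[\alpha,\beta](x,y)=\alpha x^2+xy+\beta y^2$) is $\Delta(q)=\alpha\beta\in F/\wp(F)$. -}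

module Defs where

open import Level using (Level; _⊔_; suc)
open import Data.Product using (Σ; _×_; _,_; proj₁; proj₂; ∃-syntax)
open import Relation.Nullary using (¬_)
open import Algebra.Bundles using (CommutativeRing)

-- A field: a nontrivial commutative ring in which every nonzero element
-- has a multiplicative inverse (inverse given as a total operation whose
-- value at 0 is irrelevant, as in Mathlib).
record Field (c ℓ : Level) : Set (suc (c ⊔ ℓ)) where
  field
    commutativeRing : CommutativeRing c ℓ
  open CommutativeRing commutativeRing public
  infix 8 _⁻¹
  field
    _⁻¹       : Carrier → Carrier
    ⁻¹-inverse : ∀ x → ¬ (x ≈ 0#) → x * (x ⁻¹) ≈ 1#
    1≉0       : ¬ (1# ≈ 0#)

module FieldTheory {c ℓ : Level} (F : Field c ℓ) where
  open Field F

  infixr 8 _²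
  _² : Carrier → Carrier
  x ² = x * x

  2# : Carrier
  2# = 1# + 1#

  4# : Carrier
  4# = 2# + 2#

  CharTwo : Set ℓ
  CharTwo = 2# ≈ 0#

  IsSquare : Carrier → Set (c ⊔ ℓ)
  IsSquare x = ∃[ s ] (s * s ≈ x)

  ℘ : Carrier → Carrier
  ℘ x = x * x + x

  In℘F : Carrier → Set (c ⊔ ℓ)
  In℘F x = ∃[ t ] (℘ t ≈ x)

  -- The 2-dimensional F-vector space V, realised as F × F (any 2-dimensional
  -- space is isomorphic to it; e₁ = (1,0), e₂ = (0,1) is the standard basis).
  V : Set c
  V = Carrier × Carrier

  _≈V_ : V → V → Set ℓ
  (x₁ , x₂) ≈V (y₁ , y₂) = (x₁ ≈ y₁) × (x₂ ≈ y₂)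

  infixl 6 _+V_
  infixr 7 _·V_
  infix 4 _≈V_
  _+V_ : V → V → V
  (x₁ , x₂) +V (y₁ , y₂) = (x₁ + y₁ , x₂ + y₂)

  _·V_ : Carrier → V → V
  λ' ·V (x₁ , x₂) = (λ' * x₁ , λ' * x₂)

  0V e₁ e₂ : V
  0V = (0# , 0#)
  e₁ = (1# , 0#)
  e₂ = (0# , 1#)

  polar : (V → Carrier) → V → V → Carrier
  polar q x y = q (x +V y) - q x - q y

  record IsQuadraticForm (q : V → Carrier) : Set (c ⊔ ℓ) where
    field
      cong      : ∀ {x y} → x ≈V y → q x ≈ q y
      homog     : ∀ λ' x → q (λ' ·V x) ≈ (λ' ²) * q x
      bilin-+ˡ  : ∀ x x' y → polar q (x +V x') y ≈ polar q x y + polar q x' y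
      bilin-·ˡ  : ∀ λ' x y → polar q (λ' ·V x) y ≈ λ' * polar q x y
      bilin-+ʳ  : ∀ x y y' → polar q x (y +V y') ≈ polar q x y + polar q x y'
      bilin-·ʳ  : ∀ λ' x y → polar q x (λ' ·V y) ≈ λ' * polar q x y

  NonDegenerate : (V → Carrier) → Set (c ⊔ ℓ)
  NonDegenerate q = ∀ x → (∀ y → polar q x y ≈ 0#) → x ≈V 0V

  Represents : (V → Carrier) → Carrier → Set (c ⊔ ℓ)
  Represents q a = ∃[ x ] (q x ≈ a)

  InV₁+V₁WithValue : (V → Carrier) → Carrier → Set (c ⊔ ℓ)
  InV₁+V₁WithValue q a =
    ∃[ u ] ∃[ v ] ((q u ≈ 1#) × (q v ≈ 1#) × (q (u +V v) ≈ a))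

  -- Determinant (char ≠ 2): in the standard basis q(x) = xᵀ A x with A the
  -- symmetric matrix [[q e₁ , b/2] , [b/2 , q e₂]], b = b_q(e₁,e₂);
  -- det A = q(e₁) q(e₂) - (b/2)².  Its square class is det(q).
  detMatrix : (V → Carrier) → Carrier
  detMatrix q = q e₁ * q e₂ - (polar q e₁ e₂ * (2# ⁻¹)) ²

  -- Arf invariant representative (char 2): with c = b_q(e₁,e₂) ≠ 0,
  -- (e₁ , c⁻¹ e₂) is a basis in which q ≅ [q e₁ , q (c⁻¹ e₂)], so
  -- Δ(q) = q(e₁) · q(c⁻¹ e₂) ∈ F/℘(F).
  arf : (V → Carrier) → Carrier
  arf q = q e₁ * q ((polar q e₁ e₂) ⁻¹ ·V e₂)

module Submission where

open import Defs
open import Level using (Level)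
open import Data.Product using (_×_; _,_; proj₁; proj₂)
open import Relation.Nullary using (¬_; yes; no)
open import Function.Bundles using (_⇔_; mk⇔)
open import Algebra.Bundles using (CommutativeRing; RawRing)
open import Data.Nat.Base as ℕ using (ℕ; zero; suc)
import Data.Nat.Properties as ℕ
open import Data.Integer.Base as ℤ using (ℤ; +_; -[1+_]; _⊖_; +-*-rawRing)
import Data.Integer.Properties as ℤ
open import Data.Sign.Base as Sign using (Sign)
open import Data.Maybe.Base using (Maybe; just; nothing)
import Relation.Binary.PropositionalEquality as ≡
open import Algebra.Solver.Ring.AlmostCommutativeRing
  using (_-Raw-AlmostCommutative⟶_; fromCommutativeRing)
import Algebra.Solver.Ring as RingSolver

-- Write q(x) = τ(x, x) with τ(x, y) = α x₁y₁ + γ x₁y₂ + β x₂y₂, so that b_q = τ + τᵀ.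
-- If q(u) = q(v) = 1 and q(u + v) = a, then b_q(u, v) = a - 2 and the Gram determinant
-- of b_q on (u, v) is 4a - a²; it also equals det(b_q) · det(u, v)², and det(b_q) = 4 det(q)
-- when 2 is invertible.  In characteristic 2, b_q(u, v/a) = 1 and the Lagrange identity
-- for τ gives q(u) q(v/a) = Δ(q) + ℘(τ(u, v/a)); as q(u) q(v/a) = 1/a² = ℘(1/a) + 1/a,
-- this is the claim.  Conversely, from q(r) = 1 the second vector is sought as s r + t w,
-- where w is orthogonal to r (char ≠ 2) resp. b_q(r, w) = 1 (char 2); q(s r + t w) = 1 and
-- q(r + s r + t w) = a become a quadratic equation in s, t, solvable exactly under the
-- hypothesis on det(q) resp. Δ(q).

-- The ring solver needs coefficients with decidable equality; ℤ maps into every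
-- commutative ring.
module IntegerCoefficients {c ℓ} (R : CommutativeRing c ℓ) where
  open CommutativeRing R
  open import Algebra.Properties.Ring ring
    using (-0#≈0#; -‿involutive; -‿+-comm; -1*x≈-x)
  open import Algebra.Properties.CommutativeSemigroup +-commutativeSemigroup
    using () renaming (interchange to +-interchange)
  open import Algebra.Properties.CommutativeSemigroup *-commutativeSemigroup
    using () renaming (interchange to *-interchange)
  open import Algebra.Properties.Semiring.Mult.TCOptimised semiring
    using (×-homo-+; ×1-homo-*) renaming (_×_ to _×′_)
  open import Relation.Binary.Reasoning.Setoid setoid

  ⟦_⟧ℤ : ℤ → Carrier
  ⟦ + n ⟧ℤ      = n ×′ 1#
  ⟦ -[1+ n ] ⟧ℤ = - (suc n ×′ 1#)

  private
    suc×′1 : ∀ n → suc n ×′ 1# ≈ 1# + n ×′ 1#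
    suc×′1 = ×-homo-+ 1# 1

    ⊖-homo : ∀ m n → ⟦ m ⊖ n ⟧ℤ ≈ m ×′ 1# - n ×′ 1#
    ⊖-homo m zero = begin
      ⟦ m ⊖ 0 ⟧ℤ         ≡⟨ ≡.cong ⟦_⟧ℤ (ℤ.⊖-≥ {m} ℕ.z≤n) ⟩
      m ×′ 1#            ≈⟨ +-identityʳ _ ⟨
      m ×′ 1# + 0#       ≈⟨ +-congˡ -0#≈0# ⟨
      m ×′ 1# - 0#       ∎
    ⊖-homo zero (suc n) = begin
      ⟦ 0 ⊖ suc n ⟧ℤ     ≡⟨ ≡.cong ⟦_⟧ℤ (ℤ.⊖-< {0} {suc n} (ℕ.s≤s ℕ.z≤n)) ⟩
      - (suc n ×′ 1#)    ≈⟨ +-identityˡ _ ⟨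
      0# - suc n ×′ 1#   ∎
    ⊖-homo (suc m) (suc n) = begin
      ⟦ suc m ⊖ suc n ⟧ℤ                ≡⟨ ≡.cong ⟦_⟧ℤ (ℤ.[1+m]⊖[1+n]≡m⊖n m n) ⟩
      ⟦ m ⊖ n ⟧ℤ                        ≈⟨ ⊖-homo m n ⟩
      m ×′ 1# - n ×′ 1#                 ≈⟨ +-identityˡ _ ⟨
      0# + (m ×′ 1# - n ×′ 1#)          ≈⟨ +-congʳ (-‿inverseʳ 1#) ⟨
      (1# - 1#) + (m ×′ 1# - n ×′ 1#)   ≈⟨ +-interchange _ _ _ _ ⟩
      (1# + m ×′ 1#) + (- 1# - n ×′ 1#) ≈⟨ +-congˡ (-‿+-comm 1# _) ⟩
      (1# + m ×′ 1#) - (1# + n ×′ 1#)   ≈⟨ +-cong (suc×′1 m) (-‿cong (suc×′1 n)) ⟨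
      suc m ×′ 1# - suc n ×′ 1#         ∎

    +-homo : ∀ i j → ⟦ i ℤ.+ j ⟧ℤ ≈ ⟦ i ⟧ℤ + ⟦ j ⟧ℤ
    +-homo (+ m)    (+ n)    = ×-homo-+ 1# m n
    +-homo (+ m)    -[1+ n ] = ⊖-homo m (suc n)
    +-homo -[1+ m ] (+ n)    = trans (⊖-homo n (suc m)) (+-comm _ _)
    +-homo -[1+ m ] -[1+ n ] = begin
      - (suc (suc (m ℕ.+ n)) ×′ 1#)  ≡⟨ ≡.cong (λ k → - (suc k ×′ 1#)) (ℕ.+-suc m n) ⟨
      - ((suc m ℕ.+ suc n) ×′ 1#)    ≈⟨ -‿cong (×-homo-+ 1# (suc m) (suc n)) ⟩
      - (suc m ×′ 1# + suc n ×′ 1#)  ≈⟨ -‿+-comm _ _ ⟨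
      - (suc m ×′ 1#) - suc n ×′ 1#  ∎

    ⟦_⟧ₛ : Sign → Carrier
    ⟦ Sign.+ ⟧ₛ = 1#
    ⟦ Sign.- ⟧ₛ = - 1#

    sign-homo : ∀ s t → ⟦ s Sign.* t ⟧ₛ ≈ ⟦ s ⟧ₛ * ⟦ t ⟧ₛ
    sign-homo Sign.+ t      = sym (*-identityˡ _)
    sign-homo Sign.- Sign.+ = sym (*-identityʳ _)
    sign-homo Sign.- Sign.- = begin
      1#           ≈⟨ -‿involutive 1# ⟨
      - - 1#       ≈⟨ -1*x≈-x (- 1#) ⟨
      - 1# * - 1#  ∎

    ◃-homo : ∀ s n → ⟦ s ℤ.◃ n ⟧ℤ ≈ ⟦ s ⟧ₛ * n ×′ 1#
    ◃-homo s      zero    = sym (zeroʳ _)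
    ◃-homo Sign.+ (suc n) = sym (*-identityˡ _)
    ◃-homo Sign.- (suc n) = sym (-1*x≈-x _)

    sign-abs : ∀ i → ⟦ i ⟧ℤ ≈ ⟦ ℤ.sign i ⟧ₛ * ℤ.∣ i ∣ ×′ 1#
    sign-abs (+ n)    = sym (*-identityˡ _)
    sign-abs -[1+ n ] = sym (-1*x≈-x _)

    *-homo : ∀ i j → ⟦ i ℤ.* j ⟧ℤ ≈ ⟦ i ⟧ℤ * ⟦ j ⟧ℤ
    *-homo i j = begin
      ⟦ i ℤ.* j ⟧ℤ
        ≈⟨ ◃-homo (ℤ.sign i Sign.* ℤ.sign j) (ℤ.∣ i ∣ ℕ.* ℤ.∣ j ∣) ⟩
      ⟦ ℤ.sign i Sign.* ℤ.sign j ⟧ₛ * (ℤ.∣ i ∣ ℕ.* ℤ.∣ j ∣) ×′ 1#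
        ≈⟨ *-cong (sign-homo (ℤ.sign i) (ℤ.sign j)) (×1-homo-* ℤ.∣ i ∣ ℤ.∣ j ∣) ⟩
      (⟦ ℤ.sign i ⟧ₛ * ⟦ ℤ.sign j ⟧ₛ) * (ℤ.∣ i ∣ ×′ 1# * ℤ.∣ j ∣ ×′ 1#)
        ≈⟨ *-interchange _ _ _ _ ⟩
      (⟦ ℤ.sign i ⟧ₛ * ℤ.∣ i ∣ ×′ 1#) * (⟦ ℤ.sign j ⟧ₛ * ℤ.∣ j ∣ ×′ 1#)
        ≈⟨ *-cong (sign-abs i) (sign-abs j) ⟨
      ⟦ i ⟧ℤ * ⟦ j ⟧ℤ
        ∎

    -‿homo : ∀ i → ⟦ ℤ.- i ⟧ℤ ≈ - ⟦ i ⟧ℤ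
    -‿homo (+ zero)  = sym -0#≈0#
    -‿homo (+ suc n) = refl
    -‿homo -[1+ n ]  = sym (-‿involutive _)

    homomorphism : +-*-rawRing -Raw-AlmostCommutative⟶ fromCommutativeRing R
    homomorphism = record
      { ⟦_⟧    = ⟦_⟧ℤ
      ; +-homo = +-homo
      ; *-homo = *-homo
      ; -‿homo = -‿homo
      ; 0-homo = refl
      ; 1-homo = refl
      }

    _≟_ : ∀ i j → Maybe (⟦ i ⟧ℤ ≈ ⟦ j ⟧ℤ)
    i ≟ j with i ℤ.≟ j
    ... | yes ≡.refl = just refl
    ... | no _       = nothing

  open RingSolver +-*-rawRing (fromCommutativeRing R) homomorphism _≟_ public

  polynomials : ℕ → RawRing _ _
  polynomials n = record
    { Carrier = Polynomial n
    ; _≈_     = ≡._≡_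
    ; _+_     = _:+_
    ; _*_     = _:*_
    ; -_      = :-_
    ; 0#      = con (+ 0)
    ; 1#      = con (+ 1)
    }

-- Stated over a raw ring so that, instantiated at the solver's polynomials, the same
-- definitions also provide the solver's syntax for the identities below.
module BinaryForm {c ℓ} (R : RawRing c ℓ) (α β γ : RawRing.Carrier R) where
  open RawRing R

  private
    infixl 6 _-_
    _-_ : Carrier → Carrier → Carrier
    x - y = x + - y

  _⊕_ : Carrier × Carrier → Carrier × Carrier → Carrier × Carrier
  (x₁ , x₂) ⊕ (y₁ , y₂) = (x₁ + y₁ , x₂ + y₂)

  det : Carrier × Carrier → Carrier × Carrier → Carrier
  det (x₁ , x₂) (y₁ , y₂) = x₁ * y₂ - x₂ * y₁

  τ : Carrier × Carrier → Carrier × Carrier → Carrier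
  τ (x₁ , x₂) (y₁ , y₂) = x₁ * y₁ * α + x₂ * y₂ * β + x₁ * (y₂ * γ)

  b : Carrier × Carrier → Carrier × Carrier → Carrier
  b x y = τ x y + τ y x

  -- det(b_q): the determinant of the matrix [[2α, γ], [γ, 2β]] of b.
  polarDet : Carrier
  polarDet = (α + α) * (β + β) - γ * γ

  ρ σ : Carrier × Carrier → Carrier × Carrier
  ρ (x₁ , x₂) = (- (γ * x₁ + (β + β) * x₂) , (α + α) * x₁ + γ * x₂)
  σ (x₁ , x₂) = (- (γ * x₁ + β * x₂) , α * x₁)

module BinaryFormIdentities {c ℓ} (R : CommutativeRing c ℓ) (α β γ : CommutativeRing.Carrier R) where
  open CommutativeRing R
  open IntegerCoefficients R
  open BinaryForm rawRing α β γ

  τ-polarization : ∀ x y → τ (x ⊕ y) (x ⊕ y) - τ x x - τ y y ≈ b x y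
  τ-polarization (x₁ , x₂) (y₁ , y₂) = solve 7 (λ α β γ x₁ x₂ y₁ y₂ →
    let module P = BinaryForm (polynomials 7) α β γ; x = (x₁ , x₂); y = (y₁ , y₂) in
    P.τ (x P.⊕ y) (x P.⊕ y) :- P.τ x x :- P.τ y y := P.b x y) refl α β γ x₁ x₂ y₁ y₂

  τ-skew : ∀ x y → τ x y - τ y x ≈ γ * det x y
  τ-skew (x₁ , x₂) (y₁ , y₂) = solve 7 (λ α β γ x₁ x₂ y₁ y₂ →
    let module P = BinaryForm (polynomials 7) α β γ; x = (x₁ , x₂); y = (y₁ , y₂) in
    P.τ x y :- P.τ y x := γ :* P.det x y) refl α β γ x₁ x₂ y₁ y₂

  τ≈det-σ : ∀ x y → τ x y ≈ det y (σ x)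
  τ≈det-σ (x₁ , x₂) (y₁ , y₂) = solve 7 (λ α β γ x₁ x₂ y₁ y₂ →
    let module P = BinaryForm (polynomials 7) α β γ; x = (x₁ , x₂); y = (y₁ , y₂) in
    P.τ x y := P.det y (P.σ x)) refl α β γ x₁ x₂ y₁ y₂

  b≈det-ρ : ∀ x y → b x y ≈ det y (ρ x)
  b≈det-ρ (x₁ , x₂) (y₁ , y₂) = solve 7 (λ α β γ x₁ x₂ y₁ y₂ →
    let module P = BinaryForm (polynomials 7) α β γ; x = (x₁ , x₂); y = (y₁ , y₂) in
    P.b x y := P.det y (P.ρ x)) refl α β γ x₁ x₂ y₁ y₂

  det-ρ-ρ : ∀ x y → det y (ρ (ρ x)) ≈ polarDet * det x y
  det-ρ-ρ (x₁ , x₂) (y₁ , y₂) = solve 7 (λ α β γ x₁ x₂ y₁ y₂ →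
    let module P = BinaryForm (polynomials 7) α β γ; x = (x₁ , x₂); y = (y₁ , y₂) in
    P.det y (P.ρ (P.ρ x)) := P.polarDet :* P.det x y) refl α β γ x₁ x₂ y₁ y₂

  τ-ρ : ∀ x → τ (ρ x) (ρ x) ≈ polarDet * τ x x
  τ-ρ (x₁ , x₂) = solve 5 (λ α β γ x₁ x₂ →
    let module P = BinaryForm (polynomials 5) α β γ; x = (x₁ , x₂) in
    P.τ (P.ρ x) (P.ρ x) := P.polarDet :* P.τ x x) refl α β γ x₁ x₂

  lagrange : ∀ x y → τ x x * τ y y ≈ τ x y * τ y x + α * β * (det x y * det x y)
  lagrange (x₁ , x₂) (y₁ , y₂) = solve 7 (λ α β γ x₁ x₂ y₁ y₂ →
    let module P = BinaryForm (polynomials 7) α β γ; x = (x₁ , x₂); y = (y₁ , y₂) in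
    P.τ x x :* P.τ y y := P.τ x y :* P.τ y x :+ α :* β :* (P.det x y :* P.det x y))
    refl α β γ x₁ x₂ y₁ y₂

  gram : ∀ x y → b x x * b y y - b x y * b x y ≈ polarDet * (det x y * det x y)
  gram (x₁ , x₂) (y₁ , y₂) = solve 7 (λ α β γ x₁ x₂ y₁ y₂ →
    let module P = BinaryForm (polynomials 7) α β γ; x = (x₁ , x₂); y = (y₁ , y₂) in
    P.b x x :* P.b y y :- P.b x y :* P.b x y := P.polarDet :* (P.det x y :* P.det x y))
    refl α β γ x₁ x₂ y₁ y₂

  det-self : ∀ x → det x x ≈ 0#
  det-self (x₁ , x₂) = solve 2 (λ x₁ x₂ → x₁ :* x₂ :- x₂ :* x₁ := con (+ 0)) refl x₁ x₂

  det-zeroʳ : ∀ x → det x (0# , 0#) ≈ 0#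
  det-zeroʳ (x₁ , x₂) =
    solve 2 (λ x₁ x₂ → x₁ :* con (+ 0) :- x₂ :* con (+ 0) := con (+ 0)) refl x₁ x₂

module FieldLemmas {c ℓ} (F : Field c ℓ) where
  open Field F
  open FieldTheory F
  open IntegerCoefficients commutativeRing
  open import Relation.Binary.Reasoning.Setoid setoid

  inverse-unique : ∀ {x y} → x * y ≈ 1# → y ≈ x ⁻¹
  inverse-unique {x} {y} xy≈1 = begin
    y               ≈⟨ *-identityʳ y ⟨
    y * 1#          ≈⟨ *-congˡ (⁻¹-inverse x x≉0) ⟨
    y * (x * x ⁻¹)  ≈⟨ solve 3 (λ x y z → y :* (x :* z) := x :* y :* z) refl x y (x ⁻¹) ⟩
    x * y * x ⁻¹    ≈⟨ *-congʳ xy≈1 ⟩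
    1# * x ⁻¹       ≈⟨ *-identityˡ _ ⟩
    x ⁻¹            ∎
    where
    x≉0 : ¬ x ≈ 0#
    x≉0 x≈0 = 1≉0 (trans (sym xy≈1) (trans (*-congʳ x≈0) (zeroˡ y)))

  -- Identities valid in characteristic 2 are proved as  lhs ≈ rhs + 2 * k  by the solver.
  module Char2Arithmetic (char2 : CharTwo) where

    x+2y≈x : ∀ x y → x + 2# * y ≈ x
    x+2y≈x x y = trans (+-congˡ (trans (*-congʳ char2) (zeroˡ y))) (+-identityʳ x)

    ℘-+ : ∀ x y → ℘ (x + y) ≈ ℘ x + ℘ y
    ℘-+ x y = trans
      (solve 2 (λ x y → (x :+ y) :* (x :+ y) :+ (x :+ y)
                          := x :* x :+ x :+ (y :* y :+ y) :+ con (+ 2) :* (x :* y))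
               refl x y)
      (x+2y≈x _ (x * y))

module QuadraticFormOnPlane {c ℓ} (F : Field c ℓ) (q : FieldTheory.V F → Field.Carrier F)
                            (isQ : FieldTheory.IsQuadraticForm F q) where
  open Field F
  open FieldTheory F
  open IsQuadraticForm isQ renaming (cong to q-cong)
  open IntegerCoefficients commutativeRing
  open FieldLemmas F
  open import Relation.Binary.Reasoning.Setoid setoid

  α β γ : Carrier
  α = q e₁
  β = q e₂
  γ = polar q e₁ e₂

  open BinaryForm rawRing α β γ
  open BinaryFormIdentities commutativeRing α β γ

  q-+ : ∀ x y → q (x +V y) ≈ q x + q y + polar q x y
  q-+ x y = solve 3 (λ s x y → s := x :+ y :+ (s :- x :- y)) refl (q (x +V y)) (q x) (q y)

  q-linear-combination : ∀ s t x y →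
    q (s ·V x +V t ·V y) ≈ s ² * q x + t ² * q y + s * (t * polar q x y)
  q-linear-combination s t x y = begin
    q (s ·V x +V t ·V y)
      ≈⟨ q-+ (s ·V x) (t ·V y) ⟩
    q (s ·V x) + q (t ·V y) + polar q (s ·V x) (t ·V y)
      ≈⟨ +-cong (+-cong (homog s x) (homog t y))
                (trans (bilin-·ˡ s x (t ·V y)) (*-congˡ (bilin-·ʳ t x y))) ⟩
    s ² * q x + t ² * q y + s * (t * polar q x y)
      ∎

  standard-basis : ∀ x₁ x₂ → (x₁ , x₂) ≈V x₁ ·V e₁ +V x₂ ·V e₂
  standard-basis x₁ x₂ =
    solve 2 (λ x₁ x₂ → x₁ := x₁ :* con (+ 1) :+ x₂ :* con (+ 0)) refl x₁ x₂ ,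
    solve 2 (λ x₁ x₂ → x₂ := x₁ :* con (+ 0) :+ x₂ :* con (+ 1)) refl x₁ x₂

  q≈τ : ∀ x → q x ≈ τ x x
  q≈τ (x₁ , x₂) = trans (q-cong (standard-basis x₁ x₂)) (q-linear-combination x₁ x₂ e₁ e₂)

  polar≈b : ∀ x y → polar q x y ≈ b x y
  polar≈b x y = trans (+-cong (+-cong (q≈τ (x +V y)) (-‿cong (q≈τ x))) (-‿cong (q≈τ y)))
                      (τ-polarization x y)

  polar≈det-ρ : ∀ x y → polar q x y ≈ det y (ρ x)
  polar≈det-ρ x y = trans (polar≈b x y) (b≈det-ρ x y)

  polarDet≉0 : NonDegenerate q → ¬ polarDet ≈ 0#
  polarDet≉0 nondegenerate polarDet≈0 = 1≉0 (proj₁ (nondegenerate e₁ e₁-radical))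
    where
    ρe₁≈0 : ρ e₁ ≈V 0V
    ρe₁≈0 = nondegenerate (ρ e₁) λ y → begin
      polar q (ρ e₁) y     ≈⟨ polar≈det-ρ (ρ e₁) y ⟩
      det y (ρ (ρ e₁))     ≈⟨ det-ρ-ρ e₁ y ⟩
      polarDet * det e₁ y  ≈⟨ *-congʳ polarDet≈0 ⟩
      0# * det e₁ y        ≈⟨ zeroˡ _ ⟩
      0#                   ∎
    e₁-radical : ∀ y → polar q e₁ y ≈ 0#
    e₁-radical y = begin
      polar q e₁ y     ≈⟨ polar≈det-ρ e₁ y ⟩
      det y (ρ e₁)     ≈⟨ +-cong (*-congˡ (proj₂ ρe₁≈0)) (-‿cong (*-congˡ (proj₁ ρe₁≈0))) ⟩
      det y (0# , 0#)  ≈⟨ det-zeroʳ y ⟩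
      0#               ∎

  gram-V₁ : ∀ {u v a} → q u ≈ 1# → q v ≈ 1# → q (u +V v) ≈ a →
            4# * a - a ² ≈ polarDet * det u v ²
  gram-V₁ {u} {v} {a} qu≈1 qv≈1 quv≈a = begin
    4# * a - a ²
      ≈⟨ +-cong (*-congˡ a≈2+p) (-‿cong (*-cong a≈2+p a≈2+p)) ⟩
    4# * (2# + p) - (2# + p) ²
      ≈⟨ solve 1 (λ p → (con (+ 2) :+ con (+ 2)) :* (con (+ 2) :+ p) :- (con (+ 2) :+ p) :* (con (+ 2) :+ p)
                          := con (+ 2) :* con (+ 2) :- p :* p)
                 refl p ⟩
    2# * 2# - p * p
      ≈⟨ +-cong (*-cong (b-self≈2 qu≈1) (b-self≈2 qv≈1))
                (-‿cong (*-cong (sym (polar≈b u v)) (sym (polar≈b u v)))) ⟨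
    b u u * b v v - b u v * b u v
      ≈⟨ gram u v ⟩
    polarDet * det u v ²
      ∎
    where
    p : Carrier
    p = polar q u v
    a≈2+p : a ≈ 2# + p
    a≈2+p = trans (sym quv≈a) (trans (q-+ u v) (+-congʳ (+-cong qu≈1 qv≈1)))
    b-self≈2 : ∀ {x} → q x ≈ 1# → b x x ≈ 2#
    b-self≈2 {x} qx≈1 = +-cong (trans (sym (q≈τ x)) qx≈1) (trans (sym (q≈τ x)) qx≈1)

  V₁+V₁-by-combination : ∀ {r w d p a} s t → q r ≈ 1# → q w ≈ d → polar q r w ≈ p →
                         s ² + t ² * d + s * (t * p) ≈ 1# → 2# + 2# * s + t * p ≈ a →
                         InV₁+V₁WithValue q a
  V₁+V₁-by-combination {r} {w} {d} {p} {a} s t qr≈1 qw≈d prw≈p norm≈1 sum≈a =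
    r , s ·V r +V t ·V w , qr≈1 , trans (value s t) norm≈1 , q-r+v≈a
    where
    value : ∀ s t → q (s ·V r +V t ·V w) ≈ s ² + t ² * d + s * (t * p)
    value s t = trans (q-linear-combination s t r w)
      (+-cong (+-cong (trans (*-congˡ qr≈1) (*-identityʳ _)) (*-congˡ qw≈d)) (*-congˡ (*-congˡ prw≈p)))
    shift : ∀ x y → x + (s * x + t * y) ≈ (1# + s) * x + t * y
    shift = solve 4 (λ s t x y → x :+ (s :* x :+ t :* y) := (con (+ 1) :+ s) :* x :+ t :* y) refl s t
    q-r+v≈a : q (r +V (s ·V r +V t ·V w)) ≈ a
    q-r+v≈a = begin
      q (r +V (s ·V r +V t ·V w))
        ≈⟨ q-cong (shift _ _ , shift _ _) ⟩
      q ((1# + s) ·V r +V t ·V w)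
        ≈⟨ value (1# + s) t ⟩
      (1# + s) ² + t ² * d + (1# + s) * (t * p)
        ≈⟨ solve 4 (λ s t d p → (con (+ 1) :+ s) :* (con (+ 1) :+ s) :+ t :* t :* d :+ (con (+ 1) :+ s) :* (t :* p)
                                  := s :* s :+ t :* t :* d :+ s :* (t :* p) :+ (con (+ 1) :+ con (+ 2) :* s :+ t :* p))
                   refl s t d p ⟩
      s ² + t ² * d + s * (t * p) + (1# + 2# * s + t * p)
        ≈⟨ +-congʳ norm≈1 ⟩
      1# + (1# + 2# * s + t * p)
        ≈⟨ solve 3 (λ s t p → con (+ 1) :+ (con (+ 1) :+ con (+ 2) :* s :+ t :* p)
                                := con (+ 2) :+ con (+ 2) :* s :+ t :* p)
                   refl s t p ⟩
      2# + 2# * s + t * p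
        ≈⟨ sum≈a ⟩
      a
        ∎

  module Char≢2 (char≢2 : ¬ CharTwo) where

    ½ : Carrier
    ½ = 2# ⁻¹

    2*½≈1 : 2# * ½ ≈ 1#
    2*½≈1 = ⁻¹-inverse 2# char≢2

    detMatrix≈ : detMatrix q ≈ polarDet * (½ * ½)
    detMatrix≈ = begin
      α * β - (γ * ½) ²
        ≈⟨ +-congʳ (*-identityʳ _) ⟨
      α * β * 1# - (γ * ½) ²
        ≈⟨ +-congʳ (*-congˡ (trans (*-cong 2*½≈1 2*½≈1) (*-identityʳ 1#))) ⟨
      α * β * (2# * ½ * (2# * ½)) - (γ * ½) ²
        ≈⟨ solve 4 (λ α β γ h → α :* β :* (con (+ 2) :* h :* (con (+ 2) :* h)) :- γ :* h :* (γ :* h)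
                                  := ((α :+ α) :* (β :+ β) :- γ :* γ) :* (h :* h))
                   refl α β γ ½ ⟩
      polarDet * (½ * ½)
        ∎

    V₁+V₁⇒square : ∀ {a} → InV₁+V₁WithValue q a → IsSquare (detMatrix q * (4# * a - a ²))
    V₁+V₁⇒square {a} (u , v , qu≈1 , qv≈1 , quv≈a) = polarDet * ½ * det u v , (begin
      polarDet * ½ * det u v * (polarDet * ½ * det u v)
        ≈⟨ solve 3 (λ P h δ → P :* h :* δ :* (P :* h :* δ) := P :* (h :* h) :* (P :* (δ :* δ)))
                   refl polarDet ½ (det u v) ⟩
      polarDet * (½ * ½) * (polarDet * det u v ²)
        ≈⟨ *-cong detMatrix≈ (gram-V₁ qu≈1 qv≈1 quv≈a) ⟨
      detMatrix q * (4# * a - a ²)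
        ∎)

    square⇒V₁+V₁ : ∀ {a} → NonDegenerate q → Represents q 1# →
                   IsSquare (detMatrix q * (4# * a - a ²)) → InV₁+V₁WithValue q a
    square⇒V₁+V₁ {a} nondegenerate (r , qr≈1) (s , s²≈) =
      V₁+V₁-by-combination ((a - 2#) * ½) t qr≈1 qρr≈polarDet polar-r-ρr≈0 norm≈1 sum≈a
      where
      t : Carrier
      t = s * polarDet ⁻¹
      polarDet*polarDet⁻¹≈1 : polarDet * polarDet ⁻¹ ≈ 1#
      polarDet*polarDet⁻¹≈1 = ⁻¹-inverse polarDet (polarDet≉0 nondegenerate)
      qρr≈polarDet : q (ρ r) ≈ polarDet
      qρr≈polarDet = begin
        q (ρ r)           ≈⟨ q≈τ (ρ r) ⟩
        τ (ρ r) (ρ r)     ≈⟨ τ-ρ r ⟩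
        polarDet * τ r r  ≈⟨ *-congˡ (trans (sym (q≈τ r)) qr≈1) ⟩
        polarDet * 1#     ≈⟨ *-identityʳ _ ⟩
        polarDet          ∎
      polar-r-ρr≈0 : polar q r (ρ r) ≈ 0#
      polar-r-ρr≈0 = trans (polar≈det-ρ r (ρ r)) (det-self (ρ r))
      t²polarDet≈ : t ² * polarDet ≈ (4# * a - a ²) * (½ * ½)
      t²polarDet≈ = begin
        t ² * polarDet
          ≈⟨ solve 3 (λ s e P → s :* e :* (s :* e) :* P := s :* s :* e :* (P :* e))
                     refl s (polarDet ⁻¹) polarDet ⟩
        s * s * polarDet ⁻¹ * (polarDet * polarDet ⁻¹)
          ≈⟨ trans (*-congˡ polarDet*polarDet⁻¹≈1) (*-identityʳ _) ⟩
        s * s * polarDet ⁻¹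
          ≈⟨ *-congʳ (trans s²≈ (*-congʳ detMatrix≈)) ⟩
        polarDet * (½ * ½) * (4# * a - a ²) * polarDet ⁻¹
          ≈⟨ solve 4 (λ P h x e → P :* h :* x :* e := x :* h :* (P :* e))
                     refl polarDet (½ * ½) (4# * a - a ²) (polarDet ⁻¹) ⟩
        (4# * a - a ²) * (½ * ½) * (polarDet * polarDet ⁻¹)
          ≈⟨ trans (*-congˡ polarDet*polarDet⁻¹≈1) (*-identityʳ _) ⟩
        (4# * a - a ²) * (½ * ½)
          ∎
      norm≈1 : ((a - 2#) * ½) ² + t ² * polarDet + (a - 2#) * ½ * (t * 0#) ≈ 1#
      norm≈1 = begin
        ((a - 2#) * ½) ² + t ² * polarDet + (a - 2#) * ½ * (t * 0#)
          ≈⟨ +-congʳ (+-congˡ t²polarDet≈) ⟩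
        ((a - 2#) * ½) ² + (4# * a - a ²) * (½ * ½) + (a - 2#) * ½ * (t * 0#)
          ≈⟨ solve 3 (λ a h t → (a :- con (+ 2)) :* h :* ((a :- con (+ 2)) :* h)
                                  :+ ((con (+ 2) :+ con (+ 2)) :* a :- a :* a) :* (h :* h)
                                  :+ (a :- con (+ 2)) :* h :* (t :* con (+ 0))
                                  := con (+ 2) :* h :* (con (+ 2) :* h))
                     refl a ½ t ⟩
        2# * ½ * (2# * ½)
          ≈⟨ trans (*-cong 2*½≈1 2*½≈1) (*-identityʳ 1#) ⟩
        1#
          ∎
      sum≈a : 2# + 2# * ((a - 2#) * ½) + t * 0# ≈ a
      sum≈a = begin
        2# + 2# * ((a - 2#) * ½) + t * 0#
          ≈⟨ solve 3 (λ a h t → con (+ 2) :+ con (+ 2) :* ((a :- con (+ 2)) :* h) :+ t :* con (+ 0)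
                                  := con (+ 2) :+ (a :- con (+ 2)) :* (con (+ 2) :* h))
                     refl a ½ t ⟩
        2# + (a - 2#) * (2# * ½)
          ≈⟨ +-congˡ (trans (*-congˡ 2*½≈1) (*-identityʳ _)) ⟩
        2# + (a - 2#)
          ≈⟨ solve 1 (λ a → con (+ 2) :+ (a :- con (+ 2)) := a) refl a ⟩
        a
          ∎

  module Char≡2 (char2 : CharTwo) where
    open Char2Arithmetic char2

    polar≈γdet : ∀ x y → polar q x y ≈ γ * det x y
    polar≈γdet x y = begin
      polar q x y                 ≈⟨ polar≈b x y ⟩
      τ x y + τ y x               ≈⟨ solve 2 (λ s t → s :+ t := s :- t :+ con (+ 2) :* t) refl (τ x y) (τ y x) ⟩
      τ x y - τ y x + 2# * τ y x  ≈⟨ x+2y≈x _ _ ⟩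
      τ x y - τ y x               ≈⟨ τ-skew x y ⟩
      γ * det x y                 ∎

    γ≉0 : NonDegenerate q → ¬ γ ≈ 0#
    γ≉0 nondegenerate γ≈0 = polarDet≉0 nondegenerate (begin
      (α + α) * (β + β) - γ * γ    ≈⟨ +-congˡ (-‿cong (*-cong γ≈0 γ≈0)) ⟩
      (α + α) * (β + β) - 0# * 0#  ≈⟨ solve 2 (λ α β → (α :+ α) :* (β :+ β) :- con (+ 0) :* con (+ 0)
                                                          := con (+ 0) :+ con (+ 2) :* (con (+ 2) :* α :* β))
                                               refl α β ⟩
      0# + 2# * (2# * α * β)       ≈⟨ x+2y≈x _ _ ⟩
      0#                           ∎)

    arf≈ : arf q ≈ α * β * (γ ⁻¹ * γ ⁻¹)
    arf≈ = trans (*-congˡ (homog (γ ⁻¹) e₂))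
                 (solve 3 (λ α β k → α :* (k :* k :* β) := α :* β :* (k :* k)) refl α β (γ ⁻¹))

    -- Independence of the Arf invariant from the symplectic basis.
    arf-symplectic : ∀ {f g} → polar q f g ≈ 1# → q f * q g ≈ arf q + ℘ (τ f g)
    arf-symplectic {f} {g} pfg≈1 = begin
      q f * q g
        ≈⟨ *-cong (q≈τ f) (q≈τ g) ⟩
      τ f f * τ g g
        ≈⟨ lagrange f g ⟩
      τ f g * τ g f + α * β * (det f g * det f g)
        ≈⟨ +-cong (*-congˡ τgf≈1+τfg) (*-congˡ (*-cong det≈γ⁻¹ det≈γ⁻¹)) ⟩
      τ f g * (1# + τ f g) + α * β * (γ ⁻¹ * γ ⁻¹)
        ≈⟨ +-cong (solve 1 (λ t → t :* (con (+ 1) :+ t) := t :* t :+ t) refl (τ f g)) (sym arf≈) ⟩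
      ℘ (τ f g) + arf q
        ≈⟨ +-comm _ _ ⟩
      arf q + ℘ (τ f g)
        ∎
      where
      det≈γ⁻¹ : det f g ≈ γ ⁻¹
      det≈γ⁻¹ = inverse-unique (trans (sym (polar≈γdet f g)) pfg≈1)
      τgf≈1+τfg : τ g f ≈ 1# + τ f g
      τgf≈1+τfg = begin
        τ g f
          ≈⟨ solve 2 (λ s t → t := s :+ t :+ s :+ con (+ 2) :* (:- s)) refl (τ f g) (τ g f) ⟩
        τ f g + τ g f + τ f g + 2# * - τ f g
          ≈⟨ x+2y≈x _ _ ⟩
        τ f g + τ g f + τ f g
          ≈⟨ +-congʳ (trans (sym (polar≈b f g)) pfg≈1) ⟩
        1# + τ f g
          ∎

    V₁+V₁⇒arf : ∀ {a} → ¬ a ≈ 0# → InV₁+V₁WithValue q a → In℘F (arf q + a ⁻¹)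
    V₁+V₁⇒arf {a} a≉0 (u , v , qu≈1 , qv≈1 , quv≈a) = m + t , (begin
      ℘ (m + t)              ≈⟨ ℘-+ m t ⟩
      m * m + m + ℘ t        ≈⟨ +-congʳ (+-congʳ (trans m²≈ (arf-symplectic polar-u-m·v≈1))) ⟩
      arf q + ℘ t + m + ℘ t  ≈⟨ solve 3 (λ A m T → A :+ T :+ m :+ T := A :+ m :+ con (+ 2) :* T)
                                         refl (arf q) m (℘ t) ⟩
      arf q + m + 2# * ℘ t   ≈⟨ x+2y≈x _ _ ⟩
      arf q + m              ∎)
      where
      m t : Carrier
      m = a ⁻¹
      t = τ u (m ·V v)
      polar-uv≈a : polar q u v ≈ a
      polar-uv≈a = begin
        polar q u v
          ≈⟨ solve 1 (λ p → p := con (+ 2) :+ p :+ con (+ 2) :* (:- con (+ 1))) refl (polar q u v) ⟩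
        2# + polar q u v + 2# * - 1#
          ≈⟨ x+2y≈x _ _ ⟩
        2# + polar q u v
          ≈⟨ +-congʳ (+-cong qu≈1 qv≈1) ⟨
        q u + q v + polar q u v
          ≈⟨ q-+ u v ⟨
        q (u +V v)
          ≈⟨ quv≈a ⟩
        a
          ∎
      polar-u-m·v≈1 : polar q u (m ·V v) ≈ 1#
      polar-u-m·v≈1 =
        trans (bilin-·ʳ m u v) (trans (*-congˡ polar-uv≈a) (trans (*-comm m a) (⁻¹-inverse a a≉0)))
      m²≈ : m * m ≈ q u * q (m ·V v)
      m²≈ = sym (trans (*-cong qu≈1 (trans (homog m v) (*-congˡ qv≈1)))
                       (trans (*-identityˡ _) (*-identityʳ _)))

    arf⇒V₁+V₁ : ∀ {a} → ¬ a ≈ 0# → NonDegenerate q → Represents q 1# →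
                In℘F (arf q + a ⁻¹) → InV₁+V₁WithValue q a
    arf⇒V₁+V₁ {a} a≉0 nondegenerate (r , qr≈1) (t , ℘t≈) =
      V₁+V₁-by-combination (a * s) a qr≈1 refl polar-r-g≈1 norm≈1 sum≈a
      where
      m : Carrier
      m = a ⁻¹
      g : V
      g = γ ⁻¹ ·V σ r
      polar-r-g≈1 : polar q r g ≈ 1#
      polar-r-g≈1 = begin
        polar q r g               ≈⟨ bilin-·ʳ (γ ⁻¹) r (σ r) ⟩
        γ ⁻¹ * polar q r (σ r)    ≈⟨ *-congˡ (polar≈γdet r (σ r)) ⟩
        γ ⁻¹ * (γ * det r (σ r))  ≈⟨ *-congˡ (*-congˡ det-r-σr≈1) ⟩
        γ ⁻¹ * (γ * 1#)           ≈⟨ trans (*-congˡ (*-identityʳ γ)) (*-comm _ _) ⟩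
        γ * γ ⁻¹                  ≈⟨ ⁻¹-inverse γ (γ≉0 nondegenerate) ⟩
        1#                        ∎
        where
        det-r-σr≈1 : det r (σ r) ≈ 1#
        det-r-σr≈1 = trans (sym (τ≈det-σ r r)) (trans (sym (q≈τ r)) qr≈1)
      T : Carrier
      T = ℘ (τ r g)
      qg≈arf+T : q g ≈ arf q + T
      qg≈arf+T = trans (sym (trans (*-congʳ qr≈1) (*-identityˡ _))) (arf-symplectic polar-r-g≈1)
      s : Carrier
      s = t + τ r g + m
      ℘s+qg≈m² : ℘ s + q g ≈ m * m
      ℘s+qg≈m² = begin
        ℘ s + q g
          ≈⟨ +-cong (trans (℘-+ (t + τ r g) m) (+-congʳ (℘-+ t (τ r g)))) qg≈arf+T ⟩
        ℘ t + T + ℘ m + (arf q + T)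
          ≈⟨ +-congʳ (+-congʳ (+-congʳ ℘t≈)) ⟩
        arf q + m + T + (m * m + m) + (arf q + T)
          ≈⟨ solve 3 (λ A m T → A :+ m :+ T :+ (m :* m :+ m) :+ (A :+ T) := m :* m :+ con (+ 2) :* (A :+ m :+ T))
                     refl (arf q) m T ⟩
        m * m + 2# * (arf q + m + T)
          ≈⟨ x+2y≈x _ _ ⟩
        m * m
          ∎
      norm≈1 : (a * s) ² + a ² * q g + a * s * (a * 1#) ≈ 1#
      norm≈1 = begin
        (a * s) ² + a ² * q g + a * s * (a * 1#)
          ≈⟨ solve 3 (λ a s Q → a :* s :* (a :* s) :+ a :* a :* Q :+ a :* s :* (a :* con (+ 1))
                                  := a :* a :* (s :* s :+ s :+ Q))
                     refl a s (q g) ⟩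
        a * a * (℘ s + q g)
          ≈⟨ *-congˡ ℘s+qg≈m² ⟩
        a * a * (m * m)
          ≈⟨ solve 2 (λ a m → a :* a :* (m :* m) := a :* m :* (a :* m)) refl a m ⟩
        a * m * (a * m)
          ≈⟨ trans (*-cong (⁻¹-inverse a a≉0) (⁻¹-inverse a a≉0)) (*-identityʳ 1#) ⟩
        1#
          ∎
      sum≈a : 2# + 2# * (a * s) + a * 1# ≈ a
      sum≈a = begin
        2# + 2# * (a * s) + a * 1#
          ≈⟨ solve 2 (λ a s → con (+ 2) :+ con (+ 2) :* (a :* s) :+ a :* con (+ 1)
                                := a :+ con (+ 2) :* (con (+ 1) :+ a :* s))
                     refl a s ⟩
        a + 2# * (1# + a * s)
          ≈⟨ x+2y≈x _ _ ⟩
        a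
          ∎

proposition3p13 : ∀ {c ℓ : Level} (F : Field c ℓ) → let open Field F in let open FieldTheory F in
    (q : V → Carrier) → IsQuadraticForm q → NonDegenerate q → Represents q 1# →
    (a : Carrier) → ¬ (a ≈ 0#) →
      ((¬ CharTwo) → (InV₁+V₁WithValue q a ⇔ IsSquare (detMatrix q * (4# * a - a ²))))
      × (CharTwo → (InV₁+V₁WithValue q a ⇔ In℘F (arf q + a ⁻¹)))
proposition3p13 F q isQ nondegenerate represents-1 a a≉0 =
    (λ char≢2 → mk⇔ (Char≢2.V₁+V₁⇒square char≢2)
                    (Char≢2.square⇒V₁+V₁ char≢2 nondegenerate represents-1))
  , (λ char2 → mk⇔ (Char≡2.V₁+V₁⇒arf char2 a≉0)
                   (Char≡2.arf⇒V₁+V₁ char2 a≉0 nondegenerate represents-1))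
  where open QuadraticFormOnPlane F q isQ
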